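{- Let $p\in\mathbb N$ and consider a non-terminal $\mathcal N_{BS-R}$-valid state $(w,S,v)$ with $w\in V_r$, $S\subseteq V_d$, $|S|\ge1$, $v\in S$. Let $m:=\min\{j:v_j\in S\}$ and $M:=\max\{j:v_j\in S\}$. Then for $v_i\in V_d\setminus S$, the state $(w,S\cup\{v_i\},v_i)$ is $\mathcal N_{BS-R}$-valid if and only if either $i\in[M-p+1,\max\{M-1,m+2p-1\}]$, or $i\in[\max\{M+1,m+2p\},M+p]$ and $v_j\in S$ for all $j\in[m+p,i-p]$. Moreover, for every $w'\in V_r$ the state $(w,S,w')$ is $\mathcal N_{BS-R}$-valid.
   Context: Setting: $V_d=\{v_1,\dots,v_{n_d}\}$ is a finite set of destinations and $V_r$ a finite set of replenishment locations (RLs), disjoint from $V_d$, containing $w_0,w_t$. An operation is a sequence $o=(w,v_{O1},\dots,v_{Ok},w')=wsw'$ with $w,w'\in V_r$, $k\ge1$ and $s=(v_{O1},\dots,v_{Ok})$ a sequence of distinct destinations; $\{s\}$ denotes the set of its destinations. A recharging leg is a pair $(w,w')\in V_r\times V_r$. A drone tour is an alternating sequence $(r_0,o_1,r_1,\dots,o_m,r_m)$ of recharging legs and operations, starting at $w_0$, ending at $w_t$, each piece starting at the RL where the previous one ends, visiting every destination exactly once; $\pi_d(V_d)$ is its sequence of destinations in visiting order. (No energy constraint is imposed here.) Let $x=(v_1,\dots,v_{n_d})$ and $p\in\mathbb N$. For a permutation $\sigma$ of $[n_d]$ ($\sigma(i)$ = new position of $v_i$), $x'=(v_{\sigma^{ -1}(1)},\dots,v_{\sigma^{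 -1}(n_d)})\in\mathcal N_{BS}(x,p)$ iff $\sigma(i)<\sigma(j)$ whenever $i+p\le j$. $\mathcal N_{BS-R}(x,p)$ is the set of drone tours $\pi_d$ with $\pi_d(V_d)\in\mathcal N_{BS}(x,p)$. An operation is $\mathcal N_{BS-R}$-valid if it occurs in at least one drone tour of $\mathcal N_{BS-R}(x,p)$. States: triples $(w,S,v)$ with $w\in V_r$, $S\subseteq V_d$, $v\in S\cup V_r$. Validity: every initial state $(w,\emptyset,w)$ is valid; a terminal state $(w,S,w')$ with $S\ne\emptyset$, $w'\in V_r$ is valid iff there is a valid operation $wsw'$ with $\{s\}=S$; a non-terminal state $(w,S,v)$ with $v\in S$ is valid iff there is a valid operation $wsw''$ (some $w''\in V_r$) with $\{s\}=S$ whose sequence $s$ ends in $v$. Integer intervals $[a,b]=\{a,\dots,b\}$ (empty if $a>b$). -}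

module Defs where

open import Data.Nat using (ℕ; _+_; _*_; _≤_; _<_)
open import Data.Fin using (Fin; toℕ)
open import Data.Fin.Subset using (Subset) renaming (_∈_ to _∈ₛ_)
open import Data.List using (List; []; _∷_; _++_; [_]; concat; map; length; lookup)
open import Data.List.Membership.Propositional using (_∈_)
open import Data.List.Relation.Unary.Unique.Propositional using (Unique)
open import Data.List.Relation.Unary.Any using (Any)
open import Data.List.Relation.Binary.Permutation.Propositional using (_↭_)
open import Data.Fin using (Fin)
open import Data.List using (allFin)
open import Data.Product using (Σ; ∃; ∃-syntax; _×_; _,_; proj₁; proj₂)
open import Relation.Binary.PropositionalEquality using (_≡_; _≢_)
open import Function.Bundles using (_⇔_)

-- Destinations V_d = {v_1,...,v_n} are represented by Fin n, where the
-- destination with index i (1-based in the paper) is the element with toℕ = i - 1;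
-- the reference sequence x = (v_1,...,v_n) is the natural order on Fin n.
-- Replenishment locations V_r are represented by Fin k (a finite set).

record Op (n k : ℕ) : Set where
  constructor op
  field
    start : Fin k
    seq   : List (Fin n)
    end   : Fin k
open Op public

IsOperation : ∀ {n k} → Op n k → Set
IsOperation o = (seq o ≢ []) × Unique (seq o)

Leg : ℕ → Set
Leg k = Fin k × Fin k

-- Raw drone tour (r_0, o_1, r_1, ..., o_m, r_m): first leg r_0 followed by
-- the list of pairs (o_j , r_j).
record RawTour (n k : ℕ) : Set where
  constructor tour
  field
    firstLeg : Leg k
    rest     : List (Op n k × Leg k)
open RawTour public

Chain : ∀ {n k} → Fin k → Fin k → List (Op n k × Leg k) → Set
Chain wt cur [] = cur ≡ wt
Chain wt cur ((o , r) ∷ xs) =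
  (start o ≡ cur) × IsOperation o × (proj₁ r ≡ end o) × Chain wt (proj₂ r) xs

tourOps : ∀ {n k} → RawTour n k → List (Op n k)
tourOps t = map proj₁ (rest t)

destSeq : ∀ {n k} → RawTour n k → List (Fin n)
destSeq t = concat (map seq (tourOps t))

IsDroneTour : ∀ {n k} → Fin k → Fin k → RawTour n k → Set
IsDroneTour w0 wt t =
  (proj₁ (firstLeg t) ≡ w0) × Chain wt (proj₂ (firstLeg t)) (rest t)
  × (destSeq t ↭ allFin _)

-- x' ∈ N_BS(x,p): for destinations v_i, v_j with i + p ≤ j, the position
-- σ(i) of v_i in x' is smaller than the position σ(j) of v_j in x'.
InBS : ∀ {n} → ℕ → List (Fin n) → Set
InBS p x' = ∀ (i j : Fin _) (a b : Fin (length x')) →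
  lookup x' a ≡ i → lookup x' b ≡ j → toℕ i + p ≤ toℕ j → toℕ a < toℕ b

InBSR : ∀ {n k} → Fin k → Fin k → ℕ → RawTour n k → Set
InBSR w0 wt p t = IsDroneTour w0 wt t × InBS p (destSeq t)

ValidOp : ∀ {n k} → Fin k → Fin k → ℕ → Op n k → Set
ValidOp w0 wt p o = ∃[ t ] (InBSR w0 wt p t × o ∈ tourOps t)

SetEq : ∀ {n} → List (Fin n) → Subset n → Set
SetEq s S = ∀ v → (v ∈ s ⇔ v ∈ₛ S)

ValidTerminal : ∀ {n k} → Fin k → Fin k → ℕ → Fin k → Subset n → Fin k → Set
ValidTerminal w0 wt p w S w' =
  ∃[ s ] (ValidOp w0 wt p (op w s w') × SetEq s S)

ValidNonTerminal : ∀ {n k} → Fin k → Fin k → ℕ → Fin k → Subset n → Fin n → Set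
ValidNonTerminal w0 wt p w S v =
  ∃[ s ] ∃[ w'' ] (ValidOp w0 wt p (op w s w'') × SetEq s S
                   × ∃[ s' ] (s ≡ s' ++ [ v ]))

{-# OPTIONS --safe #-}
module Submission where

-- Comparing positions, a destination sequence lies in N_BS(x,p) iff p ≥ 1 and no
-- v_j is visited before a v_b with j ≥ b + p. So an operation with destination set T
-- ending in u can be valid only if p ≥ 1, b < u + p for every b ∈ T, and T is
-- p-convex: any v_j with b₁ + p ≤ j ≤ b₂ - p for some b₁, b₂ ∈ T lies in T. These
-- conditions also suffice: visit, each by its own operation, the destinations outside T
-- that must precede an element of T, then T with u last, then the rest, all in
-- increasing order. For T = S ∪ {v_i}, given that S already satisfies them, they
-- reduce to M < i + p and v_j ∈ S for m + p ≤ j ≤ i - p, which is the stated condition.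

open import Defs
open import Data.Nat using (ℕ; _+_; _*_; _≤_; _<_)
open import Data.Fin using (Fin; toℕ)
open import Data.Fin.Subset using (Subset; _∈_; _∉_; _∪_; ⁅_⁆)
open import Data.Product using (_×_)
open import Data.Sum using (_⊎_)
open import Function.Bundles using (_⇔_)

open import Data.Nat using (zero; suc; z≤n; s≤s; s≤s⁻¹; _∸_; _<?_; _≤?_)
open import Data.Nat.Properties
open import Data.Fin using (zero; suc; fromℕ<) renaming (_≟_ to _≟ᶠ_)
open import Data.Fin.Properties using (toℕ-injective; toℕ-fromℕ<; toℕ<n) renaming (any? to anyFin?)
open import Data.Fin.Subset.Properties using (_∈?_; x∈p∪q⁻; x∈p∪q⁺; x∈⁅x⁆; x∈⁅y⁆⇒x≡y)
open import Data.List using (List; []; _∷_; _++_; [_]; concat; map; allFin; filter)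
open import Data.List.Properties using (map-++; concat-++)
open import Data.List.Relation.Unary.All as All using (All; []; _∷_)
open import Data.List.Relation.Unary.All.Properties as AllP using ()
open import Data.List.Relation.Unary.AllPairs using (AllPairs; []; _∷_)
import Data.List.Relation.Unary.AllPairs.Properties as AllPairsP
open import Data.List.Relation.Unary.Any as Any using (here; there)
open import Data.List.Relation.Unary.Any.Properties using (lookup-index)
open import Data.List.Relation.Unary.Unique.Propositional using (Unique)
import Data.List.Relation.Unary.Unique.Propositional.Properties as UniqueP
open import Data.List.Membership.Propositional using () renaming (_∈_ to _∈ₗ_)
open import Data.List.Membership.Propositional.Properties
  using (∈-++⁺ˡ; ∈-++⁺ʳ; ∈-++⁻; ∈-∃++; ∈-filter⁺; ∈-filter⁻; ∈-allFin; ∈-lookup)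
open import Data.List.Membership.Propositional.Properties.WithK using (unique∧set⇒bag)
open import Data.List.Relation.Binary.BagAndSetEquality using (∼bag⇒↭)
open import Data.List.Relation.Binary.Permutation.Propositional using (_↭_; ↭-sym)
open import Data.List.Relation.Binary.Permutation.Propositional.Properties using (∈-resp-↭)
open import Data.Product using (∃-syntax; ∃₂; _,_; proj₁; proj₂)
open import Data.Sum using (inj₁; inj₂; [_,_]′)
import Data.Sum as Sum
open import Data.Empty using (⊥-elim)
open import Relation.Nullary using (¬_; Dec; yes; no; ¬?)
open import Relation.Nullary.Decidable using (_×-dec_)
open import Relation.Binary.PropositionalEquality
  using (_≡_; _≢_; refl; sym; trans; cong; cong₂; subst; module ≡-Reasoning)
open import Relation.Binary.Definitions using (tri<; tri≈; tri>)
open import Function.Base using (_∘_)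
open import Function.Bundles using (mk⇔; Equivalence)
open import Function.Properties.Equivalence using () renaming (trans to ⇔-trans)

private
  variable
    n k : ℕ

MayPrecede : ℕ → Fin n → Fin n → Set
MayPrecede p x y = toℕ x < toℕ y + p

InBS⇒AllPairs : ∀ p (l : List (Fin n)) → InBS p l → AllPairs (MayPrecede p) l
InBS⇒AllPairs p [] _ = []
InBS⇒AllPairs p (x ∷ xs) bs =
  All.tabulate (λ {y} y∈xs → ≰⇒> λ y+p≤x →
    n≮0 (bs y x (suc (Any.index y∈xs)) zero (sym (lookup-index y∈xs)) refl y+p≤x))
  ∷ InBS⇒AllPairs p xs (λ i j a b eqᵃ eqᵇ le → s≤s⁻¹ (bs i j (suc a) (suc b) eqᵃ eqᵇ le))

AllPairs⇒InBS : ∀ {p} → 1 ≤ p → (l : List (Fin n)) → AllPairs (MayPrecede p) l → InBS p l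
AllPairs⇒InBS 1≤p (x ∷ xs) _ _ _ zero zero refl refl x+p≤x = ⊥-elim (<⇒≱ (m<m+n (toℕ x) 1≤p) x+p≤x)
AllPairs⇒InBS 1≤p (x ∷ xs) _ _ _ zero (suc b) _ _ _ = s≤s z≤n
AllPairs⇒InBS 1≤p (x ∷ xs) (x≺xs ∷ _) _ _ (suc a) zero refl refl le =
  ⊥-elim (<⇒≱ (All.lookup x≺xs (∈-lookup a)) le)
AllPairs⇒InBS 1≤p (x ∷ xs) (_ ∷ xs-ok) i j (suc a) (suc b) eqᵃ eqᵇ le =
  s≤s (AllPairs⇒InBS 1≤p xs xs-ok i j a b eqᵃ eqᵇ le)

InBS⇒1≤p : ∀ {p} {l : List (Fin n)} {x} → InBS p l → x ∈ₗ l → 1 ≤ p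
InBS⇒1≤p {p = zero} bs x∈l =
  ⊥-elim (<-irrefl refl (bs _ _ (Any.index x∈l) (Any.index x∈l) refl refl
    (≤-reflexive (+-identityʳ _))))
InBS⇒1≤p {p = suc _} _ _ = s≤s z≤n

AllPairs-++⁻ : ∀ {A : Set} {R : A → A → Set} (xs ys : List A) → AllPairs R (xs ++ ys) →
  AllPairs R xs × AllPairs R ys × All (λ x → All (R x) ys) xs
AllPairs-++⁻ [] ys ys-ok = [] , ys-ok , []
AllPairs-++⁻ (x ∷ xs) ys (x≺ ∷ rest) with AllPairs-++⁻ xs ys rest | AllP.++⁻ xs x≺
... | xs-ok , ys-ok , cross | x≺xs , x≺ys = (x≺xs ∷ xs-ok) , ys-ok , (x≺ys ∷ cross)

AllPairs-middle⁻ : ∀ {A : Set} {R : A → A → Set} (xs ys zs : List A) → AllPairs R (xs ++ ys ++ zs) →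
  All (λ x → All (R x) ys) xs × AllPairs R ys × All (λ y → All (R y) zs) ys
AllPairs-middle⁻ xs ys zs ordered with AllPairs-++⁻ xs (ys ++ zs) ordered
... | _ , ys++zs-ordered , xs≺ys++zs with AllPairs-++⁻ ys zs ys++zs-ordered
...   | ys-ordered , _ , ys≺zs = All.map (proj₁ ∘ AllP.++⁻ ys) xs≺ys++zs , ys-ordered , ys≺zs

CanEndAt : ℕ → Subset n → Fin n → Set
CanEndAt p T u = ∀ b → b ∈ T → MayPrecede p b u

Convex : ℕ → Subset n → Set
Convex {n} p T = ∀ (j : Fin n) {b₁ b₂} → b₁ ∈ T → b₂ ∈ T →
  toℕ b₁ + p ≤ toℕ j → toℕ j + p ≤ toℕ b₂ → j ∈ T

destSeq-++ : (ys zs : List (Op n k)) (o : Op n k) →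
  concat (map seq (ys ++ o ∷ zs)) ≡ concat (map seq ys) ++ seq o ++ concat (map seq zs)
destSeq-++ ys zs o =
  trans (cong concat (map-++ seq ys (o ∷ zs))) (sym (concat-++ (map seq ys) (seq o ∷ map seq zs)))

validOp⇒split : ∀ {w0 wt : Fin k} {p w w'} {s : List (Fin n)} → ValidOp w0 wt p (op w s w') →
  ∃₂ λ A B → (A ++ s ++ B ↭ allFin n) × InBS p (A ++ s ++ B)
validOp⇒split (t , ((_ , _ , perm) , bs) , o∈t) with ∈-∃++ o∈t
... | ys , zs , ops≡ =
  concat (map seq ys) , concat (map seq zs) ,
  subst (_↭ allFin _) dest≡ perm , subst (InBS _) dest≡ bs
  where dest≡ = trans (cong (concat ∘ map seq) ops≡) (destSeq-++ ys zs _)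

-- A v_j with b₁ + p ≤ j and j + p ≤ b₂ can be visited neither before the operation
-- (b₁ must precede it) nor after it (it must precede b₂).
split⇒convex : ∀ {p} (A s B : List (Fin n)) {T} → SetEq s T →
  A ++ s ++ B ↭ allFin n → AllPairs (MayPrecede p) (A ++ s ++ B) → Convex p T
split⇒convex A s B s≈T perm ordered j {b₁} {b₂} b₁∈T b₂∈T b₁+p≤j j+p≤b₂
  with AllPairs-middle⁻ A s B ordered | ∈-++⁻ A (∈-resp-↭ (↭-sym perm) (∈-allFin j))
... | A≺s , _ , _ | inj₁ j∈A =
  ⊥-elim (<⇒≱ (All.lookup (All.lookup A≺s j∈A) (Equivalence.from (s≈T b₁) b₁∈T)) b₁+p≤j)
... | _ , _ , s≺B | inj₂ j∈s++B with ∈-++⁻ s j∈s++B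
...   | inj₁ j∈s = Equivalence.to (s≈T j) j∈s
...   | inj₂ j∈B =
  ⊥-elim (<⇒≱ (All.lookup (All.lookup s≺B (Equivalence.from (s≈T b₂) b₂∈T)) j∈B) j+p≤b₂)

valid⇒admissible : ∀ {w0 wt w : Fin k} {p} {T : Subset n} {u} → ValidNonTerminal w0 wt p w T u →
  1 ≤ p × CanEndAt p T u × Convex p T
valid⇒admissible {p = p} {T} {u} (_ , _ , valid , s≈T , s' , refl) with validOp⇒split valid
... | A , B , perm , bs = 1≤p , canEnd , split⇒convex A (s' ++ [ u ]) B s≈T perm ordered
  where
  ordered = InBS⇒AllPairs p _ bs
  1≤p = InBS⇒1≤p bs (∈-++⁺ʳ A (∈-++⁺ˡ (∈-++⁺ʳ s' (here refl))))
  s'≺u : All (λ b → All (MayPrecede p b) [ u ]) s'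
  s'≺u = proj₂ (proj₂ (AllPairs-++⁻ s' [ u ] (proj₁ (proj₂ (AllPairs-middle⁻ A _ B ordered)))))
  canEnd : CanEndAt p T u
  canEnd b b∈T with ∈-++⁻ s' (Equivalence.from (s≈T b) b∈T)
  ... | inj₁ b∈s' = All.head (All.lookup s'≺u b∈s')
  ... | inj₂ (here refl) = m<m+n (toℕ b) 1≤p

viaHub : Fin k → Fin k → List (Op n k) → List (Op n k × Leg k)
viaHub w wt [] = []
viaHub w wt (o ∷ []) = (o , (end o , wt)) ∷ []
viaHub w wt (o ∷ o₂ ∷ os) = (o , (end o , w)) ∷ viaHub w wt (o₂ ∷ os)

viaHub-ops : (w wt : Fin k) (os : List (Op n k)) → map proj₁ (viaHub w wt os) ≡ os
viaHub-ops w wt [] = refl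
viaHub-ops w wt (o ∷ []) = refl
viaHub-ops w wt (o ∷ o₂ ∷ os) = cong (o ∷_) (viaHub-ops w wt (o₂ ∷ os))

viaHub-chain : ∀ {w wt : Fin k} {o : Op n k} (os : List (Op n k)) → o ∈ₗ os →
  All (λ o → start o ≡ w × IsOperation o) os → Chain wt w (viaHub w wt os)
viaHub-chain (o ∷ []) _ ((starts , isOp) ∷ []) = starts , isOp , refl , refl
viaHub-chain (o ∷ o₂ ∷ os) _ ((starts , isOp) ∷ rest) =
  starts , isOp , refl , viaHub-chain (o₂ ∷ os) (here refl) rest

visitAlone : Fin k → Fin n → Op n k
visitAlone w x = op w [ x ] w

visitAlone-ok : (w : Fin k) (l : List (Fin n)) →
  All (λ o → start o ≡ w × IsOperation o) (map (visitAlone w) l)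
visitAlone-ok w [] = []
visitAlone-ok w (x ∷ l) = (refl , (λ ()) , ([] ∷ [])) ∷ visitAlone-ok w l

destSeq-visitAlone : (w : Fin k) (l : List (Fin n)) → concat (map seq (map (visitAlone w) l)) ≡ l
destSeq-visitAlone w [] = refl
destSeq-visitAlone w (x ∷ l) = cong (x ∷_) (destSeq-visitAlone w l)

allFin-ordered : ∀ {p} → AllPairs (MayPrecede p) (allFin n)
allFin-ordered {p = p} = AllPairsP.tabulate⁺-< (λ {_} {j} i<j → ≤-trans i<j (m≤m+n (toℕ j) p))

∷ʳ-nonempty : ∀ {A : Set} (xs : List A) y → xs ++ [ y ] ≢ []
∷ʳ-nonempty [] y ()
∷ʳ-nonempty (x ∷ xs) y ()

module CanonicalTour (w0 wt : Fin k) {p} (w w' : Fin k) {T : Subset n} {u : Fin n}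
  (u∈T : u ∈ T) (1≤p : 1 ≤ p) (canEnd : CanEndAt p T u) (convex : Convex p T) where

  MustPrecede : Fin n → Set
  MustPrecede j = ∃[ b ] b ∈ T × toℕ j + p ≤ toℕ b

  MustPrecede? : ∀ j → Dec (MustPrecede j)
  MustPrecede? j = anyFin? (λ b → (b ∈? T) ×-dec (toℕ j + p ≤? toℕ b))

  Before? : ∀ j → Dec (j ∉ T × MustPrecede j)
  Before? j = ¬? (j ∈? T) ×-dec MustPrecede? j

  Inner? : ∀ j → Dec (j ∈ T × j ≢ u)
  Inner? j = (j ∈? T) ×-dec ¬? (j ≟ᶠ u)

  After? : ∀ j → Dec (j ∉ T × ¬ MustPrecede j)
  After? j = ¬? (j ∈? T) ×-dec ¬? (MustPrecede? j)

  before inner after s route : List (Fin n)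
  before = filter Before? (allFin n)
  inner = filter Inner? (allFin n)
  after = filter After? (allFin n)
  s = inner ++ [ u ]
  route = before ++ s ++ after

  before-spec : ∀ {j} → j ∈ₗ before → j ∉ T × MustPrecede j
  before-spec = proj₂ ∘ ∈-filter⁻ Before? {xs = allFin n}

  inner-spec : ∀ {j} → j ∈ₗ inner → j ∈ T × j ≢ u
  inner-spec = proj₂ ∘ ∈-filter⁻ Inner? {xs = allFin n}

  after-spec : ∀ {j} → j ∈ₗ after → j ∉ T × ¬ MustPrecede j
  after-spec = proj₂ ∘ ∈-filter⁻ After? {xs = allFin n}

  s⊆T : ∀ {j} → j ∈ₗ s → j ∈ T
  s⊆T j∈s with ∈-++⁻ inner j∈s
  ... | inj₁ j∈inner = proj₁ (inner-spec j∈inner)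
  ... | inj₂ (here refl) = u∈T

  T⊆s : ∀ {j} → j ∈ T → j ∈ₗ s
  T⊆s {j} j∈T with j ≟ᶠ u
  ... | yes refl = ∈-++⁺ʳ inner (here refl)
  ... | no j≢u = ∈-++⁺ˡ (∈-filter⁺ Inner? (∈-allFin j) (j∈T , j≢u))

  s≈T : SetEq s T
  s≈T j = mk⇔ s⊆T T⊆s

  route-complete : ∀ j → j ∈ₗ route
  route-complete j with j ∈? T | MustPrecede? j
  ... | yes j∈T | _ = ∈-++⁺ʳ before (∈-++⁺ˡ (T⊆s j∈T))
  ... | no j∉T | yes must = ∈-++⁺ˡ (∈-filter⁺ Before? (∈-allFin j) (j∉T , must))
  ... | no j∉T | no ¬must = ∈-++⁺ʳ before (∈-++⁺ʳ s (∈-filter⁺ After? (∈-allFin j) (j∉T , ¬must)))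

  s-unique : Unique s
  s-unique = UniqueP.++⁺ (UniqueP.filter⁺ Inner? (UniqueP.allFin⁺ n)) ([] ∷ [])
    λ { (u∈inner , here refl) → proj₂ (inner-spec u∈inner) refl }

  route-unique : Unique route
  route-unique = UniqueP.++⁺ (UniqueP.filter⁺ Before? (UniqueP.allFin⁺ n))
    (UniqueP.++⁺ s-unique (UniqueP.filter⁺ After? (UniqueP.allFin⁺ n))
      λ (j∈s , j∈after) → proj₁ (after-spec j∈after) (s⊆T j∈s))
    λ (j∈before , j∈s++after) →
      [ (λ j∈s → proj₁ (before-spec j∈before) (s⊆T j∈s))
      , (λ j∈after → proj₂ (after-spec j∈after) (proj₂ (before-spec j∈before))) ]′
      (∈-++⁻ s j∈s++after)

  route↭allFin : route ↭ allFin n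
  route↭allFin = ∼bag⇒↭ (unique∧set⇒bag route-unique (UniqueP.allFin⁺ n)
    (mk⇔ (λ _ → ∈-allFin _) (λ _ → route-complete _)))

  s-ordered : AllPairs (MayPrecede p) s
  s-ordered = AllPairsP.++⁺ (AllPairsP.filter⁺ Inner? allFin-ordered) ([] ∷ [])
    (All.tabulate λ b∈inner → canEnd _ (proj₁ (inner-spec b∈inner)) ∷ [])

  s++after-ordered : AllPairs (MayPrecede p) (s ++ after)
  s++after-ordered = AllPairsP.++⁺ s-ordered (AllPairsP.filter⁺ After? allFin-ordered)
    (All.tabulate λ {x} x∈s → All.tabulate λ y∈after →
      ≰⇒> λ y+p≤x → proj₂ (after-spec y∈after) (x , s⊆T x∈s , y+p≤x))

  before≺ : ∀ {x y} → x ∈ₗ before → (y ∈ₗ s) ⊎ (y ∈ₗ after) → MayPrecede p x y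
  before≺ {x} {y} x∈before (inj₁ y∈s) with before-spec x∈before
  ... | x∉T , (b , b∈T , x+p≤b) = ≰⇒> λ y+p≤x → x∉T (convex x (s⊆T y∈s) b∈T y+p≤x x+p≤b)
  before≺ {x} {y} x∈before (inj₂ y∈after) with before-spec x∈before
  ... | _ , (b , b∈T , x+p≤b) =
    <-trans (<-≤-trans (m<m+n (toℕ x) 1≤p) x+p≤b)
            (≰⇒> λ y+p≤b → proj₂ (after-spec y∈after) (b , b∈T , y+p≤b))

  route-ordered : AllPairs (MayPrecede p) route
  route-ordered = AllPairsP.++⁺ (AllPairsP.filter⁺ Before? allFin-ordered) s++after-ordered
    (All.tabulate λ x∈before → All.tabulate λ y∈s++after → before≺ x∈before (∈-++⁻ s y∈s++after))

  ops : List (Op n k)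
  ops = map (visitAlone w) before ++ op w s w' ∷ map (visitAlone w) after

  operation∈ops : op w s w' ∈ₗ ops
  operation∈ops = ∈-++⁺ʳ (map (visitAlone w) before) (here refl)

  droneTour : RawTour n k
  droneTour = tour (w0 , w) (viaHub w wt ops)

  destSeq≡route : destSeq droneTour ≡ route
  destSeq≡route = begin
    concat (map seq (map proj₁ (viaHub w wt ops)))
      ≡⟨ cong (concat ∘ map seq) (viaHub-ops w wt ops) ⟩
    concat (map seq ops)
      ≡⟨ destSeq-++ (map (visitAlone w) before) (map (visitAlone w) after) (op w s w') ⟩
    concat (map seq (map (visitAlone w) before)) ++ s ++ concat (map seq (map (visitAlone w) after))
      ≡⟨ cong₂ (λ xs ys → xs ++ s ++ ys)
               (destSeq-visitAlone w before) (destSeq-visitAlone w after) ⟩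
    route ∎
    where open ≡-Reasoning

  validOp : ValidOp w0 wt p (op w s w')
  validOp =
    droneTour ,
    ( ( refl
      , viaHub-chain ops operation∈ops
          (AllP.++⁺ (visitAlone-ok w before)
                    ((refl , ∷ʳ-nonempty inner u , s-unique) ∷ visitAlone-ok w after))
      , subst (_↭ allFin n) (sym destSeq≡route) route↭allFin)
    , subst (InBS p) (sym destSeq≡route) (AllPairs⇒InBS 1≤p route route-ordered)) ,
    subst (op w s w' ∈ₗ_) (sym (viaHub-ops w wt ops)) operation∈ops

validNonTerminal⇔admissible : ∀ {w0 wt w : Fin k} {p} {T : Subset n} {u} → 1 ≤ p → u ∈ T →
  ValidNonTerminal w0 wt p w T u ⇔ (CanEndAt p T u × Convex p T)
validNonTerminal⇔admissible {w0 = w0} {wt} {w} {p} {T} {u} 1≤p u∈T = mk⇔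
  (λ valid → proj₂ (valid⇒admissible {u = u} valid))
  λ (canEnd , convex) → let open CanonicalTour w0 wt {p} w w {T} {u} u∈T 1≤p canEnd convex
                        in s , w , validOp , s≈T , inner , refl

admissible⇒validTerminal : ∀ {w0 wt w : Fin k} {p} {T : Subset n} {u} → 1 ≤ p → u ∈ T →
  CanEndAt p T u → Convex p T → ∀ w' → ValidTerminal w0 wt p w T w'
admissible⇒validTerminal {w0 = w0} {wt} {w} {p} {T} {u} 1≤p u∈T canEnd convex w' = s , validOp , s≈T
  where open CanonicalTour w0 wt {p} w w' {T} {u} u∈T 1≤p canEnd convex

FilledBetween : ℕ → Subset n → Fin n → Fin n → Set
FilledBetween {n} p S m i = ∀ (j : Fin n) → toℕ m + p ≤ toℕ j → toℕ j + p ≤ toℕ i → j ∈ S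

ExtensionCondition : ℕ → Subset n → (m M i : Fin n) → Set
ExtensionCondition p S m M i =
  ((toℕ M + 1 ≤ toℕ i + p) × ((toℕ i < toℕ M) ⊎ (toℕ i < toℕ m + 2 * p)))
  ⊎ (((toℕ M < toℕ i) × (toℕ m + 2 * p ≤ toℕ i) × (toℕ i ≤ toℕ M + p)) × FilledBetween p S m i)

∈-∪⁅⁆⁻ : ∀ {S : Subset n} {i j} → j ∈ S ∪ ⁅ i ⁆ → (j ∈ S) ⊎ (j ≡ i)
∈-∪⁅⁆⁻ {S = S} {i} j∈ = Sum.map₂ (x∈⁅y⁆⇒x≡y i) (x∈p∪q⁻ S ⁅ i ⁆ j∈)

canEndAt-∪⁅⁆⇔ : ∀ {p} {S : Subset n} {M i : Fin n} → 1 ≤ p → M ∈ S →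
  (∀ (j : Fin n) → j ∈ S → toℕ j ≤ toℕ M) →
  CanEndAt p (S ∪ ⁅ i ⁆) i ⇔ toℕ M < toℕ i + p
canEndAt-∪⁅⁆⇔ {p = p} {M = M} {i} 1≤p M∈S ≤M = mk⇔
  (λ canEnd → canEnd M (x∈p∪q⁺ (inj₁ M∈S)))
  λ M<i+p b b∈ →
    [ (λ b∈S → ≤-<-trans (≤M b b∈S) M<i+p) , (λ { refl → m<m+n (toℕ i) 1≤p }) ]′ (∈-∪⁅⁆⁻ b∈)

convex-∪⁅⁆⇒filled : ∀ {p} {S : Subset n} {m i : Fin n} → 1 ≤ p → m ∈ S →
  Convex p (S ∪ ⁅ i ⁆) → FilledBetween p S m i
convex-∪⁅⁆⇒filled {i = i} 1≤p m∈S convex j m+p≤j j+p≤i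
  with ∈-∪⁅⁆⁻ (convex j (x∈p∪q⁺ (inj₁ m∈S)) (x∈p∪q⁺ (inj₂ (x∈⁅x⁆ i))) m+p≤j j+p≤i)
... | inj₁ j∈S = j∈S
... | inj₂ refl = ⊥-elim (<⇒≱ (m<m+n (toℕ j) 1≤p) j+p≤i)

filled⇒convex-∪⁅⁆ : ∀ {p} {S : Subset n} {m M i : Fin n} → 1 ≤ p → Convex p S →
  (∀ (j : Fin n) → j ∈ S → toℕ m ≤ toℕ j × toℕ j ≤ toℕ M) →
  toℕ M < toℕ i + p → FilledBetween p S m i → Convex p (S ∪ ⁅ i ⁆)
filled⇒convex-∪⁅⁆ {p = p} {S} {i = i} 1≤p convex bounds M<i+p filled j b₁∈ b₂∈ b₁+p≤j j+p≤b₂ =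
  x∈p∪q⁺ (inj₁ (j∈S (∈-∪⁅⁆⁻ b₁∈) (∈-∪⁅⁆⁻ b₂∈) b₁+p≤j j+p≤b₂))
  where
  j∈S : ∀ {b₁ b₂} → (b₁ ∈ S) ⊎ (b₁ ≡ i) → (b₂ ∈ S) ⊎ (b₂ ≡ i) →
    toℕ b₁ + p ≤ toℕ j → toℕ j + p ≤ toℕ b₂ → j ∈ S
  j∈S (inj₁ b₁∈S) (inj₁ b₂∈S) b₁+p≤j j+p≤b₂ = convex j b₁∈S b₂∈S b₁+p≤j j+p≤b₂
  j∈S (inj₁ b₁∈S) (inj₂ refl) b₁+p≤j j+p≤i =
    filled j (≤-trans (+-monoˡ-≤ p (proj₁ (bounds _ b₁∈S))) b₁+p≤j) j+p≤i
  j∈S (inj₂ refl) (inj₁ b₂∈S) i+p≤j j+p≤b₂ =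
    ⊥-elim (<⇒≱ M<i+p
      (≤-trans i+p≤j (≤-trans (m≤m+n (toℕ j) p) (≤-trans j+p≤b₂ (proj₂ (bounds _ b₂∈S))))))
  j∈S (inj₂ refl) (inj₂ refl) i+p≤j j+p≤i =
    ⊥-elim (<⇒≱ (m<m+n (toℕ i) 1≤p) (≤-trans i+p≤j (≤-trans (m≤m+n (toℕ j) p) j+p≤i)))

admissible-∪⁅⁆⇔ : ∀ {p} {S : Subset n} {m M i : Fin n} → 1 ≤ p → Convex p S → m ∈ S → M ∈ S →
  (∀ (j : Fin n) → j ∈ S → toℕ m ≤ toℕ j × toℕ j ≤ toℕ M) →
  (CanEndAt p (S ∪ ⁅ i ⁆) i × Convex p (S ∪ ⁅ i ⁆)) ⇔ (toℕ M < toℕ i + p × FilledBetween p S m i)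
admissible-∪⁅⁆⇔ 1≤p convex m∈S M∈S bounds = mk⇔
  (λ (canEnd , convex′) → to canEnd , convex-∪⁅⁆⇒filled 1≤p m∈S convex′)
  λ (M<i+p , filled) → from M<i+p , filled⇒convex-∪⁅⁆ 1≤p convex bounds M<i+p filled
  where open Equivalence (canEndAt-∪⁅⁆⇔ 1≤p M∈S (λ j → proj₂ ∘ bounds j))

m+2n≡m+n+n : ∀ m n → m + 2 * n ≡ m + n + n
m+2n≡m+n+n m n rewrite +-identityʳ n = sym (+-assoc m n n)

-- v_{i-p} lies in S, so i - p ≤ M.
filled⇒≤+p : ∀ {p} {S : Subset n} {m M i : Fin n} → (∀ (j : Fin n) → j ∈ S → toℕ j ≤ toℕ M) →
  toℕ m + 2 * p ≤ toℕ i → FilledBetween p S m i → toℕ i ≤ toℕ M + p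
filled⇒≤+p {p = p} {S} {m} {M} {i} ≤M m+2p≤i filled = begin
  toℕ i          ≡⟨ m∸n+n≡m p≤i ⟨
  toℕ i ∸ p + p  ≡⟨ cong (_+ p) toℕj≡i∸p ⟨
  toℕ j + p      ≤⟨ +-monoˡ-≤ p (≤M j j∈S) ⟩
  toℕ M + p      ∎
  where
  open ≤-Reasoning
  m+p+p≤i : toℕ m + p + p ≤ toℕ i
  m+p+p≤i = subst (_≤ toℕ i) (m+2n≡m+n+n (toℕ m) p) m+2p≤i
  p≤i : p ≤ toℕ i
  p≤i = ≤-trans (m≤n+m p (toℕ m + p)) m+p+p≤i
  j = fromℕ< (≤-<-trans (m∸n≤m (toℕ i) p) (toℕ<n i))
  toℕj≡i∸p : toℕ j ≡ toℕ i ∸ p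
  toℕj≡i∸p = toℕ-fromℕ< _
  j∈S : j ∈ S
  j∈S = filled j (subst (toℕ m + p ≤_) (sym toℕj≡i∸p) (m+n≤o⇒m≤o∸n (toℕ m + p) m+p+p≤i))
                 (subst (λ x → x + p ≤ toℕ i) (sym toℕj≡i∸p) (≤-reflexive (m∸n+n≡m p≤i)))

extensionCondition⇔ : ∀ {p} {S : Subset n} {m M i : Fin n} → Convex p S → m ∈ S → M ∈ S →
  (∀ (j : Fin n) → j ∈ S → toℕ j ≤ toℕ M) → i ∉ S →
  (toℕ M < toℕ i + p × FilledBetween p S m i) ⇔ ExtensionCondition p S m M i
extensionCondition⇔ {p = p} {S} {m} {M} {i} convex m∈S M∈S ≤M i∉S = mk⇔ to from
  where
  <⇒+1≤ : toℕ M < toℕ i + p → toℕ M + 1 ≤ toℕ i + p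
  <⇒+1≤ = subst (_≤ toℕ i + p) (+-comm 1 (toℕ M))

  +1≤⇒< : toℕ M + 1 ≤ toℕ i + p → toℕ M < toℕ i + p
  +1≤⇒< = subst (_≤ toℕ i + p) (+-comm (toℕ M) 1)

  to : toℕ M < toℕ i + p × FilledBetween p S m i → ExtensionCondition p S m M i
  to (M<i+p , filled) with <-cmp (toℕ i) (toℕ M) | toℕ i <? toℕ m + 2 * p
  ... | tri< i<M _ _ | _ = inj₁ (<⇒+1≤ M<i+p , inj₁ i<M)
  ... | tri≈ _ i≡M _ | _ = ⊥-elim (i∉S (subst (_∈ S) (sym (toℕ-injective i≡M)) M∈S))
  ... | tri> _ _ M<i | yes i<m+2p = inj₁ (<⇒+1≤ M<i+p , inj₂ i<m+2p)
  ... | tri> _ _ M<i | no i≮m+2p =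
    inj₂ ((M<i , ≮⇒≥ i≮m+2p , filled⇒≤+p ≤M (≮⇒≥ i≮m+2p) filled) , filled)

  from : ExtensionCondition p S m M i → toℕ M < toℕ i + p × FilledBetween p S m i
  from (inj₁ (M+1≤i+p , inj₁ i<M)) =
    +1≤⇒< M+1≤i+p , λ j m+p≤j j+p≤i → convex j m∈S M∈S m+p≤j (≤-trans j+p≤i (<⇒≤ i<M))
  from (inj₁ (M+1≤i+p , inj₂ i<m+2p)) =
    +1≤⇒< M+1≤i+p , λ j m+p≤j j+p≤i → ⊥-elim (<⇒≱ i<m+2p
      (subst (_≤ toℕ i) (sym (m+2n≡m+n+n (toℕ m) p)) (≤-trans (+-monoˡ-≤ p m+p≤j) j+p≤i)))
  from (inj₂ ((M<i , _ , _) , filled)) = <-≤-trans M<i (m≤m+n (toℕ i) p) , filled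

lemma1 : ∀ {n k : ℕ} (w0 wt : Fin k) (p : ℕ) (w : Fin k) (S : Subset n) (v : Fin n)
    → v ∈ S
    → ValidNonTerminal w0 wt p w S v
    → (m M : Fin n) → m ∈ S → M ∈ S
    → (∀ j → j ∈ S → (toℕ m ≤ toℕ j) × (toℕ j ≤ toℕ M))
    → ((i : Fin n) → i ∉ S →
         (ValidNonTerminal w0 wt p w (S ∪ ⁅ i ⁆) i
          ⇔ (((toℕ M + 1 ≤ toℕ i + p) × ((toℕ i < toℕ M) ⊎ (toℕ i < toℕ m + 2 * p)))
             ⊎ (((toℕ M < toℕ i) × (toℕ m + 2 * p ≤ toℕ i) × (toℕ i ≤ toℕ M + p))
                × (∀ (j : Fin n) → toℕ m + p ≤ toℕ j → toℕ j + p ≤ toℕ i → j ∈ S)))))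
      × (∀ (w' : Fin k) → ValidTerminal w0 wt p w S w')
lemma1 w0 wt p w S v v∈S valid m M m∈S M∈S bounds with valid⇒admissible valid
... | 1≤p , canEnd , convex = extension , admissible⇒validTerminal 1≤p v∈S canEnd convex
  where
  extension : ∀ i → i ∉ S → ValidNonTerminal w0 wt p w (S ∪ ⁅ i ⁆) i ⇔ ExtensionCondition p S m M i
  extension i i∉S =
    ⇔-trans (validNonTerminal⇔admissible 1≤p (x∈p∪q⁺ (inj₂ (x∈⁅x⁆ i))))
   (⇔-trans (admissible-∪⁅⁆⇔ 1≤p convex m∈S M∈S bounds)
            (extensionCondition⇔ convex m∈S M∈S (λ j → proj₂ ∘ bounds j) i∉S))
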